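{- Let $u, v \in \mathbb{R}^d$ and $W \in \mathbb{R}^{d\times d}$ with $\langle u, v\rangle = 1$, and define the power series $r(x) = \sum_{k=0}^\infty u^T W^k v\, x^k$. Then $$\frac{1}{r(x)} = 1 - \sum_{\ell=1}^\infty u^T W (W - vu^TW)^{\ell-1} v\, x^\ell = \sum_{k=0}^\infty \widetilde u^T \widetilde W_0^k \widetilde v\, x^k$$ and $$\frac{1}{r(x)(1-x)} = \sum_{k=0}^\infty \widetilde u^T\widetilde W_1^k\widetilde v\, x^k,$$ where for $\beta \in \{0,1\}$, $$\widetilde W_\beta = \begin{pmatrix}\beta & 0\cdots0\\ v & W - vu^TW\end{pmatrix} \in \mathbb{R}^{(d+1)\times(d+1)},\quad \widetilde u = \begin{pmatrix}1\\ -W^Tu\end{pmatrix}\in\mathbb{R}^{d+1},\quad \widetilde v = (1,0,\dots,0)^T \in \mathbb{R}^{d+1}.$$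
   Context: The identities are identities of formal power series in $x$ (products and reciprocals taken in the ring of formal power series; $r$ is invertible since its constant term is $\langle u,v\rangle = 1$). -}

module Defs where

open import Level using (_⊔_)
open import Data.Nat using (ℕ; zero; suc; _∸_)
open import Data.Fin using (Fin; toℕ) renaming (zero to fz; suc to fs)
open import Algebra.Bundles using (CommutativeRing)

module FPS {c ℓ} (R : CommutativeRing c ℓ) where
  open CommutativeRing R

  ∑ : (n : ℕ) → (Fin n → Carrier) → Carrier
  ∑ zero    f = 0#
  ∑ (suc n) f = f fz + ∑ n (λ i → f (fs i))

  Vector : ℕ → Set c
  Vector n = Fin n → Carrier

  Mat : ℕ → ℕ → Set c
  Mat m n = Fin m → Fin n → Carrier

  dot : ∀ {n} → Vector n → Vector n → Carrier
  dot {n} u v = ∑ n (λ i → u i * v i)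

  _⊗_ : ∀ {m n p} → Mat m n → Mat n p → Mat m p
  _⊗_ {n = n} A B i j = ∑ n (λ k → A i k * B k j)

  mulV : ∀ {m n} → Mat m n → Vector n → Vector m
  mulV {n = n} A x i = ∑ n (λ k → A i k * x k)

  transpose : ∀ {m n} → Mat m n → Mat n m
  transpose A i j = A j i

  idMat : ∀ {n} → Mat n n
  idMat fz     fz     = 1#
  idMat fz     (fs j) = 0#
  idMat (fs i) fz     = 0#
  idMat (fs i) (fs j) = idMat i j

  pow : ∀ {n} → Mat n n → ℕ → Mat n n
  pow A zero    = idMat
  pow A (suc k) = A ⊗ pow A k

  bil : ∀ {n} → Vector n → Mat n n → Vector n → Carrier
  bil u A v = dot u (mulV A v)

  Series : Set c
  Series = ℕ → Carrier

  _≈ₛ_ : Series → Series → Set ℓ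
  f ≈ₛ g = ∀ n → f n ≈ g n

  _⋆_ : Series → Series → Series
  (f ⋆ g) n = ∑ (suc n) (λ i → f (toℕ i) * g (n ∸ toℕ i))

  oneS : Series
  oneS zero    = 1#
  oneS (suc n) = 0#

  oneMinusX : Series
  oneMinusX zero          = 1#
  oneMinusX (suc zero)    = - 1#
  oneMinusX (suc (suc n)) = 0#

  module Setup {d : ℕ} (u v : Vector d) (W : Mat d d) where
    r : Series
    r k = bil u (pow W k) v

    uW : Vector d
    uW j = ∑ d (λ k → u k * W k j)

    M : Mat d d
    M i j = W i j - v i * uW j

    s : Series
    s zero    = 1#
    s (suc l) = - bil u (W ⊗ pow M l) v

    Wt : Carrier → Mat (suc d) (suc d)
    Wt β fz     fz     = β
    Wt β fz     (fs j) = 0#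
    Wt β (fs i) fz     = v i
    Wt β (fs i) (fs j) = M i j

    ut : Vector (suc d)
    ut fz     = 1#
    ut (fs i) = - mulV (transpose W) u i

    vt : Vector (suc d)
    vt fz     = 1#
    vt (fs i) = 0#

    t : Carrier → Series
    t β k = bil ut (pow (Wt β) k) vt

-- Write W = M + v (uᵀW). Since uᵀv = 1 this forces uᵀM = 0, and peeling one W at a time off
-- uᵀ Wⁿ⁺¹ v through this splitting gives r(n+1) = Σ_{i≤n} r(i) b(n-i) with b(j) = uᵀ W Mʲ v,
-- i.e. r·(1 - x b) = 1; and 1 - x b is exactly s. For the block matrices, W̃₀ᵐ⁺¹ ṽ = (0, Mᵐ v)
-- and W̃₁ᵏ ṽ = (1, Σ_{j<k} Mʲ v), so ũ picks out the coefficients of s and of its partial sums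
-- s/(1 - x) respectively.
module Submission where

open import Defs
open import Data.Nat using (ℕ; zero; suc; _∸_)
open import Data.Nat.Properties using (n∸n≡0; +-∸-assoc)
open import Data.Fin using (Fin; toℕ; inject₁; fromℕ) renaming (zero to fz; suc to fs)
open import Data.Fin.Properties using (toℕ-inject₁; toℕ-fromℕ; toℕ≤pred[n])
open import Data.Vec.Functional using (_∷_)
open import Data.Product using (_×_; _,_)
open import Function using (_∘_)
open import Algebra.Bundles using (CommutativeRing)
import Algebra.Properties.Ring as RingProperties
import Algebra.Properties.AbelianGroup as AbelianGroupProperties
import Algebra.Properties.CommutativeSemigroup as CommutativeSemigroupProperties
import Algebra.Properties.Semiring.Sum as SemiringSum
import Data.Vec.Functional.Relation.Binary.Equality.Setoid as VectorEquality
import Relation.Binary.Reasoning.Setoid as SetoidReasoning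
open import Relation.Binary.PropositionalEquality as ≡ using (_≡_)

module FPS-Properties {c ℓ} (R : CommutativeRing c ℓ) where
  open CommutativeRing R
  open FPS R
  open RingProperties ring using (-1*x≈-x; -0#≈0#; x[y-z]≈xy-xz; [y-z]x≈yx-zx)
  open CommutativeSemigroupProperties *-commutativeSemigroup
    using () renaming (x∙yz≈y∙xz to x*yz≈y*xz; xy∙z≈y∙xz to xy*z≈y*xz)
  open CommutativeSemigroupProperties +-commutativeSemigroup using (xy∙z≈y∙zx)
  open SemiringSum semiring
    using (sum; sum-cong-≋; sum-replicate-zero; sum-init-last; *-distribˡ-sum)
    renaming (∑-distrib-+ to sum-distrib-+; ∑-comm to sum-comm)
  open VectorEquality setoid using (_≋_)
  open SetoidReasoning setoid

  ∑≡sum : ∀ n (f : Vector n) → ∑ n f ≡ sum f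
  ∑≡sum zero    f = ≡.refl
  ∑≡sum (suc n) f = ≡.cong (f fz +_) (∑≡sum n (f ∘ fs))

  ∑-cong : ∀ n {f g : Vector n} → f ≋ g → ∑ n f ≈ ∑ n g
  ∑-cong n {f} {g} f≋g rewrite ∑≡sum n f | ∑≡sum n g = sum-cong-≋ f≋g

  ∑-zero : ∀ n → ∑ n (λ _ → 0#) ≈ 0#
  ∑-zero n rewrite ∑≡sum n (λ _ → 0#) = sum-replicate-zero n

  ∑-init-last : ∀ n (f : Vector (suc n)) → ∑ (suc n) f ≈ ∑ n (f ∘ inject₁) + f (fromℕ n)
  ∑-init-last n f rewrite ∑≡sum (suc n) f | ∑≡sum n (f ∘ inject₁) = sum-init-last f

  ∑-distrib-+ : ∀ n (f g : Vector n) → ∑ n (λ i → f i + g i) ≈ ∑ n f + ∑ n g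
  ∑-distrib-+ n f g
    rewrite ∑≡sum n (λ i → f i + g i) | ∑≡sum n f | ∑≡sum n g = sum-distrib-+ f g

  *-distribˡ-∑ : ∀ n x (f : Vector n) → x * ∑ n f ≈ ∑ n (λ i → x * f i)
  *-distribˡ-∑ n x f rewrite ∑≡sum n f | ∑≡sum n (λ i → x * f i) = *-distribˡ-sum x f

  *-distribʳ-∑ : ∀ n x (f : Vector n) → ∑ n f * x ≈ ∑ n (λ i → f i * x)
  *-distribʳ-∑ n x f = begin
    ∑ n f * x               ≈⟨ *-comm _ x ⟩
    x * ∑ n f               ≈⟨ *-distribˡ-∑ n x f ⟩
    ∑ n (λ i → x * f i)     ≈⟨ ∑-cong n (λ i → *-comm x (f i)) ⟩
    ∑ n (λ i → f i * x)     ∎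

  -‿distrib-∑ : ∀ n (f : Vector n) → - ∑ n f ≈ ∑ n (λ i → - f i)
  -‿distrib-∑ n f = begin
    - ∑ n f                 ≈⟨ -1*x≈-x _ ⟨
    - 1# * ∑ n f            ≈⟨ *-distribˡ-∑ n (- 1#) f ⟩
    ∑ n (λ i → - 1# * f i)  ≈⟨ ∑-cong n (λ i → -1*x≈-x (f i)) ⟩
    ∑ n (λ i → - f i)       ∎

  ∑-distrib-- : ∀ n (f g : Vector n) → ∑ n (λ i → f i - g i) ≈ ∑ n f - ∑ n g
  ∑-distrib-- n f g = begin
    ∑ n (λ i → f i - g i)       ≈⟨ ∑-distrib-+ n f (λ i → - g i) ⟩
    ∑ n f + ∑ n (λ i → - g i)   ≈⟨ +-congˡ (-‿distrib-∑ n g) ⟨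
    ∑ n f - ∑ n g               ∎

  ∑-comm : ∀ m n (f : Fin m → Fin n → Carrier) →
           ∑ m (λ i → ∑ n (f i)) ≈ ∑ n (λ j → ∑ m (λ i → f i j))
  ∑-comm m n f = begin
    ∑ m (λ i → ∑ n (f i))           ≈⟨ ∑-cong m (λ i → reflexive (∑≡sum n (f i))) ⟩
    ∑ m (λ i → sum (f i))           ≡⟨ ∑≡sum m _ ⟩
    sum (λ i → sum (f i))           ≈⟨ sum-comm f ⟩
    sum (λ j → sum (λ i → f i j))   ≡⟨ ∑≡sum n _ ⟨
    ∑ n (λ j → sum (λ i → f i j))   ≈⟨ ∑-cong n (λ j → reflexive (∑≡sum m _)) ⟨
    ∑ n (λ j → ∑ m (λ i → f i j))   ∎

  dot-cong : ∀ {n} {u u′ x x′ : Vector n} → u ≋ u′ → x ≋ x′ → dot u x ≈ dot u′ x′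
  dot-cong {n} u≋u′ x≋x′ = ∑-cong n (λ i → *-cong (u≋u′ i) (x≋x′ i))

  dot-congʳ : ∀ {n} (u : Vector n) {x x′ : Vector n} → x ≋ x′ → dot u x ≈ dot u x′
  dot-congʳ u = dot-cong {u = u} (λ _ → refl)

  dot-zeroʳ : ∀ {n} (u : Vector n) → dot u (λ _ → 0#) ≈ 0#
  dot-zeroʳ {n} u = trans (∑-cong n (λ i → zeroʳ (u i))) (∑-zero n)

  dot-distribʳ-+ : ∀ {n} (u x y : Vector n) → dot u (λ i → x i + y i) ≈ dot u x + dot u y
  dot-distribʳ-+ {n} u x y =
    trans (∑-cong n (λ i → distribˡ (u i) (x i) (y i))) (∑-distrib-+ n _ _)

  dot-*ʳ : ∀ {n} (u x : Vector n) a → dot u (λ i → a * x i) ≈ a * dot u x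
  dot-*ʳ {n} u x a =
    trans (∑-cong n (λ i → x*yz≈y*xz (u i) a (x i))) (sym (*-distribˡ-∑ n a _))

  dot-linearʳ : ∀ {n} (u x y : Vector n) a →
                dot u (λ i → x i + a * y i) ≈ dot u x + a * dot u y
  dot-linearʳ u x y a = trans (dot-distribʳ-+ u x _) (+-congˡ (dot-*ʳ u y a))

  dot-mulV-transpose : ∀ {m n} (A : Mat m n) (x : Vector m) (y : Vector n) →
                       dot (mulV (transpose A) x) y ≈ dot x (mulV A y)
  dot-mulV-transpose {m} {n} A x y = begin
    ∑ n (λ j → ∑ m (λ k → A k j * x k) * y j)
      ≈⟨ ∑-cong n (λ j → *-distribʳ-∑ m (y j) _) ⟩
    ∑ n (λ j → ∑ m (λ k → (A k j * x k) * y j))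
      ≈⟨ ∑-comm m n _ ⟨
    ∑ m (λ k → ∑ n (λ j → (A k j * x k) * y j))
      ≈⟨ ∑-cong m (λ k → ∑-cong n (λ j → xy*z≈y*xz (A k j) (x k) (y j))) ⟩
    ∑ m (λ k → ∑ n (λ j → x k * (A k j * y j)))
      ≈⟨ ∑-cong m (λ k → *-distribˡ-∑ n (x k) _) ⟨
    ∑ m (λ k → x k * ∑ n (λ j → A k j * y j))
      ∎

  ∷-cong : ∀ {n} {α α′} {x x′ : Vector n} → α ≈ α′ → x ≋ x′ → (α ∷ x) ≋ (α′ ∷ x′)
  ∷-cong α≈α′ x≋x′ fz     = α≈α′
  ∷-cong α≈α′ x≋x′ (fs i) = x≋x′ i

  mulV-cong : ∀ {m n} (A : Mat m n) {x y : Vector n} → x ≋ y → mulV A x ≋ mulV A y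
  mulV-cong A x≋y i = dot-congʳ (A i) x≋y

  mulV-zero : ∀ {m n} (A : Mat m n) → mulV A (λ _ → 0#) ≋ (λ _ → 0#)
  mulV-zero A i = dot-zeroʳ (A i)

  mulV-distrib-+ : ∀ {m n} (A : Mat m n) (x y : Vector n) →
                   mulV A (λ j → x j + y j) ≋ (λ i → mulV A x i + mulV A y i)
  mulV-distrib-+ A x y i = dot-distribʳ-+ (A i) x y

  mulV-linear : ∀ {m n} (A : Mat m n) (x y : Vector n) a →
                mulV A (λ j → x j + a * y j) ≋ (λ i → mulV A x i + a * mulV A y i)
  mulV-linear A x y a i = dot-linearʳ (A i) x y a

  mulV-⊗ : ∀ {m n p} (A : Mat m n) (B : Mat n p) (x : Vector p) →
           mulV (A ⊗ B) x ≋ mulV A (mulV B x)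
  mulV-⊗ {n = n} A B x i = begin
    dot ((A ⊗ B) i) x                   ≈⟨ dot-cong (λ k → ∑-cong n (λ l → *-comm (A i l) (B l k)))
                                                     (λ _ → refl) ⟩
    dot (mulV (transpose B) (A i)) x    ≈⟨ dot-mulV-transpose B (A i) x ⟩
    dot (A i) (mulV B x)                ∎

  mulV-idMat : ∀ {n} (x : Vector n) → mulV idMat x ≋ x
  mulV-idMat {suc n} x fz =
    trans (+-cong (*-identityˡ (x fz)) (trans (∑-cong n (λ k → zeroˡ (x (fs k)))) (∑-zero n)))
          (+-identityʳ (x fz))
  mulV-idMat {suc n} x (fs i) =
    trans (+-cong (zeroˡ (x fz)) (mulV-idMat (x ∘ fs) i)) (+-identityˡ (x (fs i)))

  powV : ∀ {n} → Mat n n → ℕ → Vector n → Vector n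
  powV A zero    x = x
  powV A (suc k) x = mulV A (powV A k x)

  mulV-pow : ∀ {n} (A : Mat n n) k (x : Vector n) → mulV (pow A k) x ≋ powV A k x
  mulV-pow A zero    x i = mulV-idMat x i
  mulV-pow A (suc k) x i = trans (mulV-⊗ A (pow A k) x i) (mulV-cong A (mulV-pow A k x) i)

  powV-cong : ∀ {n} (A : Mat n n) k {x y : Vector n} → x ≋ y → powV A k x ≋ powV A k y
  powV-cong A zero    x≋y = x≋y
  powV-cong A (suc k) x≋y = mulV-cong A (powV-cong A k x≋y)

  powV-sucʳ : ∀ {n} (A : Mat n n) k (x : Vector n) → powV A (suc k) x ≡ powV A k (mulV A x)
  powV-sucʳ A zero    x = ≡.refl
  powV-sucʳ A (suc k) x = ≡.cong (mulV A) (powV-sucʳ A k x)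

  powV-linear : ∀ {n} (A : Mat n n) k (x y : Vector n) a →
                powV A k (λ j → x j + a * y j) ≋ (λ i → powV A k x i + a * powV A k y i)
  powV-linear A zero    x y a i = refl
  powV-linear A (suc k) x y a i =
    trans (mulV-cong A (powV-linear A k x y a) i) (mulV-linear A (powV A k x) (powV A k y) a i)

  infixl 6 _+ₛ_ _-ₛ_

  _+ₛ_ : Series → Series → Series
  (f +ₛ g) n = f n + g n

  _-ₛ_ : Series → Series → Series
  (f -ₛ g) n = f n - g n

  shift : Series → Series
  shift f zero    = 0#
  shift f (suc n) = f n

  shift-cong : ∀ {f g} → f ≈ₛ g → shift f ≈ₛ shift g
  shift-cong f≈g zero    = refl
  shift-cong f≈g (suc n) = f≈g n

  ⋆-term : Series → Series → ∀ n → Vector (suc n)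
  ⋆-term f g n i = f (toℕ i) * g (n ∸ toℕ i)

  ⋆-cong : ∀ {f f′ g g′} → f ≈ₛ f′ → g ≈ₛ g′ → (f ⋆ g) ≈ₛ (f′ ⋆ g′)
  ⋆-cong f≈f′ g≈g′ n = ∑-cong (suc n) (λ i → *-cong (f≈f′ (toℕ i)) (g≈g′ (n ∸ toℕ i)))

  ⋆-sucʳ : ∀ f g n → (f ⋆ g) (suc n) ≈ (f ⋆ (g ∘ suc)) n + f (suc n) * g 0
  ⋆-sucʳ f g n = begin
    ∑ (suc (suc n)) term                                      ≈⟨ ∑-init-last (suc n) term ⟩
    ∑ (suc n) (term ∘ inject₁) + term (fromℕ (suc n))         ≈⟨ +-cong (∑-cong (suc n) (reflexive ∘ init-term))
                                                                        (reflexive last-term) ⟩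
    (f ⋆ (g ∘ suc)) n + f (suc n) * g 0                       ∎
    where
    term : Vector (suc (suc n))
    term i = f (toℕ i) * g (suc n ∸ toℕ i)
    init-term : ∀ i → term (inject₁ i) ≡ f (toℕ i) * g (suc (n ∸ toℕ i))
    init-term i rewrite toℕ-inject₁ i | +-∸-assoc 1 (toℕ≤pred[n] i) = ≡.refl
    last-term : term (fromℕ (suc n)) ≡ f (suc n) * g 0
    last-term rewrite toℕ-fromℕ n | n∸n≡0 n = ≡.refl

  ⋆-distribˡ-+ : ∀ f g h → (f ⋆ (g +ₛ h)) ≈ₛ (f ⋆ g +ₛ f ⋆ h)
  ⋆-distribˡ-+ f g h n =
    trans (∑-cong (suc n) {⋆-term f (g +ₛ h) n} (λ i → distribˡ (f (toℕ i)) _ _))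
          (∑-distrib-+ (suc n) (⋆-term f g n) (⋆-term f h n))

  ⋆-distribˡ-- : ∀ f g h → (f ⋆ (g -ₛ h)) ≈ₛ (f ⋆ g -ₛ f ⋆ h)
  ⋆-distribˡ-- f g h n =
    trans (∑-cong (suc n) {⋆-term f (g -ₛ h) n} (λ i → x[y-z]≈xy-xz (f (toℕ i)) _ _))
          (∑-distrib-- (suc n) (⋆-term f g n) (⋆-term f h n))

  ⋆-distribʳ-- : ∀ f g h → ((f -ₛ g) ⋆ h) ≈ₛ (f ⋆ h -ₛ g ⋆ h)
  ⋆-distribʳ-- f g h n =
    trans (∑-cong (suc n) {⋆-term (f -ₛ g) h n} (λ i → [y-z]x≈yx-zx (h (n ∸ toℕ i)) _ _))
          (∑-distrib-- (suc n) (⋆-term f h n) (⋆-term g h n))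

  ⋆-zeroʳ : ∀ f → (f ⋆ (λ _ → 0#)) ≈ₛ (λ _ → 0#)
  ⋆-zeroʳ f n = dot-zeroʳ {suc n} (f ∘ toℕ)

  ⋆-identityʳ : ∀ f → (f ⋆ oneS) ≈ₛ f
  ⋆-identityʳ f zero    = trans (+-identityʳ _) (*-identityʳ (f 0))
  ⋆-identityʳ f (suc n) = begin
    (f ⋆ oneS) (suc n)                    ≈⟨ ⋆-sucʳ f oneS n ⟩
    (f ⋆ (λ _ → 0#)) n + f (suc n) * 1#   ≈⟨ +-cong (⋆-zeroʳ f n) (*-identityʳ (f (suc n))) ⟩
    0# + f (suc n)                        ≈⟨ +-identityˡ (f (suc n)) ⟩
    f (suc n)                             ∎

  shift-⋆ : ∀ f g → (shift f ⋆ g) ≈ₛ shift (f ⋆ g)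
  shift-⋆ f g zero    = trans (+-identityʳ _) (zeroˡ (g 0))
  shift-⋆ f g (suc n) = trans (+-congʳ (zeroˡ (g (suc n)))) (+-identityˡ _)

  ⋆-shift : ∀ f g → (f ⋆ shift g) ≈ₛ shift (f ⋆ g)
  ⋆-shift f g zero    = trans (+-identityʳ _) (zeroʳ (f 0))
  ⋆-shift f g (suc n) =
    trans (⋆-sucʳ f (shift g) n) (trans (+-congˡ (zeroʳ (f (suc n)))) (+-identityʳ _))

  oneMinusX≈1-x : oneMinusX ≈ₛ (oneS -ₛ shift oneS)
  oneMinusX≈1-x zero          = sym (trans (+-congˡ -0#≈0#) (+-identityʳ 1#))
  oneMinusX≈1-x (suc zero)    = sym (+-identityˡ (- 1#))
  oneMinusX≈1-x (suc (suc n)) = sym (trans (+-congˡ -0#≈0#) (+-identityʳ 0#))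

  ⋆-oneMinusX : ∀ f → (f ⋆ oneMinusX) ≈ₛ (f -ₛ shift f)
  ⋆-oneMinusX f n = begin
    (f ⋆ oneMinusX) n                     ≈⟨ ⋆-cong {f} (λ _ → refl) oneMinusX≈1-x n ⟩
    (f ⋆ (oneS -ₛ shift oneS)) n          ≈⟨ ⋆-distribˡ-- f oneS (shift oneS) n ⟩
    (f ⋆ oneS) n - (f ⋆ shift oneS) n     ≈⟨ +-cong (⋆-identityʳ f n) (-‿cong (⋆-shift f oneS n)) ⟩
    f n - shift (f ⋆ oneS) n              ≈⟨ +-congˡ (-‿cong (shift-cong (⋆-identityʳ f) n)) ⟩
    f n - shift f n                       ∎

  -- Reading E k j as the entries of an array, the recurrence lets one walk from
  -- E (n + 1) 0 up the antidiagonal to row 0, collecting one term of the product per step.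
  ⋆-unroll : (E : ℕ → Series) (b : Series) →
             (∀ k j → E (suc k) j ≈ E k (suc j) + b j * E k 0) →
             ∀ n → ((λ k → E k 0) ⋆ b) n + E 0 (suc n) ≈ E (suc n) 0
  ⋆-unroll E b E-suc zero = begin
    (E 0 0 * b 0 + 0#) + E 0 1   ≈⟨ +-congʳ (trans (+-identityʳ _) (*-comm _ _)) ⟩
    b 0 * E 0 0 + E 0 1          ≈⟨ +-comm _ _ ⟩
    E 0 1 + b 0 * E 0 0          ≈⟨ E-suc 0 0 ⟨
    E 1 0                        ∎
  ⋆-unroll E b E-suc (suc n) = begin
    (E 0 0 * b (suc n) + (E′0 ⋆ b) n) + E 0 (suc (suc n))   ≈⟨ xy∙z≈y∙zx _ _ _ ⟩
    (E′0 ⋆ b) n + (E 0 (suc (suc n)) + E 0 0 * b (suc n))   ≈⟨ +-congˡ (+-congˡ (*-comm _ _)) ⟩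
    (E′0 ⋆ b) n + (E 0 (suc (suc n)) + b (suc n) * E 0 0)   ≈⟨ +-congˡ (E-suc 0 (suc n)) ⟨
    (E′0 ⋆ b) n + E 1 (suc n)                               ≈⟨ ⋆-unroll (E ∘ suc) b (λ k → E-suc (suc k)) n ⟩
    E (suc (suc n)) 0                                       ∎
    where
    E′0 : Series
    E′0 k = E (suc k) 0

module Proposition22 {c ℓ} (R : CommutativeRing c ℓ) {d : ℕ}
  (u v : FPS.Vector R d) (W : FPS.Mat R d d)
  (u·v≈1 : CommutativeRing._≈_ R (FPS.dot R u v) (CommutativeRing.1# R)) where

  open CommutativeRing R
  open FPS R
  open FPS-Properties R
  open Setup u v W
  open RingProperties ring using (-‿distribˡ-*; -‿+-comm; -0#≈0#; [y-z]x≈yx-zx)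
  open AbelianGroupProperties +-abelianGroup using (xyx⁻¹≈y; //-rightDividesˡ; //-rightDividesʳ)
  open VectorEquality setoid using (_≋_; ≋-trans)
  open SetoidReasoning setoid

  Mʲv : ℕ → Vector d
  Mʲv j = powV M j v

  b : Series
  b j = dot u (mulV W (Mʲv j))

  mulV-M : ∀ x → mulV M x ≋ (λ i → mulV W x i - v i * dot u (mulV W x))
  mulV-M x i = begin
    ∑ d (λ j → (W i j - v i * uW j) * x j)          ≈⟨ ∑-cong d (λ j → [y-z]x≈yx-zx (x j) _ _) ⟩
    ∑ d (λ j → W i j * x j - (v i * uW j) * x j)    ≈⟨ ∑-distrib-- d _ _ ⟩
    mulV W x i - ∑ d (λ j → (v i * uW j) * x j)     ≈⟨ +-congˡ (-‿cong v·uW≈) ⟩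
    mulV W x i - v i * dot u (mulV W x)             ∎
    where
    uW≋Wᵀu : uW ≋ mulV (transpose W) u
    uW≋Wᵀu j = ∑-cong d (λ k → *-comm (u k) (W k j))
    v·uW≈ : ∑ d (λ j → (v i * uW j) * x j) ≈ v i * dot u (mulV W x)
    v·uW≈ = begin
      ∑ d (λ j → (v i * uW j) * x j)    ≈⟨ ∑-cong d (λ j → *-assoc (v i) (uW j) (x j)) ⟩
      ∑ d (λ j → v i * (uW j * x j))    ≈⟨ *-distribˡ-∑ d (v i) _ ⟨
      v i * dot uW x                    ≈⟨ *-congˡ (dot-cong uW≋Wᵀu (λ _ → refl)) ⟩
      v i * dot (mulV (transpose W) u) x ≈⟨ *-congˡ (dot-mulV-transpose W u x) ⟩
      v i * dot u (mulV W x)            ∎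

  mulV-W : ∀ x → mulV W x ≋ (λ i → mulV M x i + dot u (mulV W x) * v i)
  mulV-W x i = begin
    mulV W x i                                ≈⟨ //-rightDividesˡ (v i * β) (mulV W x i) ⟨
    (mulV W x i - v i * β) + v i * β          ≈⟨ +-cong (mulV-M x i) (*-comm β (v i)) ⟨
    mulV M x i + β * v i                      ∎
    where
    β = dot u (mulV W x)

  uᵀM≈0 : ∀ x → dot u (mulV M x) ≈ 0#
  uᵀM≈0 x = begin
    dot u (mulV M x)                ≈⟨ //-rightDividesʳ β (dot u (mulV M x)) ⟨
    (dot u (mulV M x) + β) - β      ≈⟨ +-congʳ uᵀWx≈uᵀMx+uᵀWx ⟨
    β - β                           ≈⟨ -‿inverseʳ β ⟩
    0#                              ∎
    where
    β = dot u (mulV W x)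
    uᵀWx≈uᵀMx+uᵀWx : β ≈ dot u (mulV M x) + β
    uᵀWx≈uᵀMx+uᵀWx = begin
      β                                     ≈⟨ dot-congʳ u (mulV-W x) ⟩
      dot u (λ i → mulV M x i + β * v i)    ≈⟨ dot-linearʳ u (mulV M x) v β ⟩
      dot u (mulV M x) + β * dot u v        ≈⟨ +-congˡ (trans (*-congˡ u·v≈1) (*-identityʳ β)) ⟩
      dot u (mulV M x) + β                  ∎

  E : ℕ → Series
  E k j = dot u (powV W k (Mʲv j))

  E-suc : ∀ k j → E (suc k) j ≈ E k (suc j) + b j * E k 0
  E-suc k j = begin
    dot u (powV W (suc k) (Mʲv j))                                ≡⟨ ≡.cong (dot u) (powV-sucʳ W k (Mʲv j)) ⟩
    dot u (powV W k (mulV W (Mʲv j)))                             ≈⟨ dot-congʳ u (powV-cong W k (mulV-W (Mʲv j))) ⟩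
    dot u (powV W k (λ i → Mʲv (suc j) i + b j * v i))            ≈⟨ dot-congʳ u (powV-linear W k _ v (b j)) ⟩
    dot u (λ i → powV W k (Mʲv (suc j)) i + b j * powV W k v i)   ≈⟨ dot-linearʳ u _ _ (b j) ⟩
    E k (suc j) + b j * E k 0                                     ∎

  r≈E : ∀ k → r k ≈ E k 0
  r≈E k = dot-congʳ u (mulV-pow W k v)

  r⋆b≈r∘suc : ∀ n → (r ⋆ b) n ≈ r (suc n)
  r⋆b≈r∘suc n = begin
    (r ⋆ b) n                                   ≈⟨ ⋆-cong {g = b} r≈E (λ _ → refl) n ⟩
    ((λ k → E k 0) ⋆ b) n                       ≈⟨ +-identityʳ _ ⟨
    ((λ k → E k 0) ⋆ b) n + 0#                  ≈⟨ +-congˡ (uᵀM≈0 (Mʲv n)) ⟨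
    ((λ k → E k 0) ⋆ b) n + E 0 (suc n)         ≈⟨ ⋆-unroll E b E-suc n ⟩
    E (suc n) 0                                 ≈⟨ r≈E (suc n) ⟨
    r (suc n)                                   ∎

  s-suc : ∀ m → s (suc m) ≈ - b m
  s-suc m = -‿cong (dot-congʳ u λ i →
    trans (mulV-⊗ W (pow M m) v i) (mulV-cong W (mulV-pow M m v) i))

  s≈1-x·b : s ≈ₛ (oneS -ₛ shift b)
  s≈1-x·b zero    = sym (trans (+-congˡ -0#≈0#) (+-identityʳ 1#))
  s≈1-x·b (suc m) = trans (s-suc m) (sym (+-identityˡ _))

  r⋆s≈1 : (r ⋆ s) ≈ₛ oneS
  r⋆s≈1 n = begin
    (r ⋆ s) n                           ≈⟨ ⋆-cong {r} (λ _ → refl) s≈1-x·b n ⟩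
    (r ⋆ (oneS -ₛ shift b)) n           ≈⟨ ⋆-distribˡ-- r oneS (shift b) n ⟩
    (r ⋆ oneS) n - (r ⋆ shift b) n      ≈⟨ +-cong (⋆-identityʳ r n) (-‿cong (⋆-shift r b n)) ⟩
    r n - shift (r ⋆ b) n               ≈⟨ r-x·[r⋆b]≈1 n ⟩
    oneS n                              ∎
    where
    r-x·[r⋆b]≈1 : ∀ n → r n - shift (r ⋆ b) n ≈ oneS n
    r-x·[r⋆b]≈1 zero    = trans (+-congˡ -0#≈0#) (trans (+-identityʳ (r 0)) (trans (r≈E 0) u·v≈1))
    r-x·[r⋆b]≈1 (suc n) = trans (+-congˡ (-‿cong (r⋆b≈r∘suc n))) (-‿inverseʳ (r (suc n)))

  Wt-mulV-∷ : ∀ β α (x : Vector d) → mulV (Wt β) (α ∷ x) ≋ (β * α) ∷ (λ i → v i * α + mulV M x i)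
  Wt-mulV-∷ β α x fz     =
    trans (+-congˡ (trans (∑-cong d (λ j → zeroˡ (x j))) (∑-zero d))) (+-identityʳ (β * α))
  Wt-mulV-∷ β α x (fs i) = refl

  vt≋1∷0 : vt ≋ 1# ∷ (λ _ → 0#)
  vt≋1∷0 fz     = refl
  vt≋1∷0 (fs i) = refl

  ut-dot-∷ : ∀ α x → dot ut (α ∷ x) ≈ α - dot u (mulV W x)
  ut-dot-∷ α x = begin
    1# * α + ∑ d (λ i → - mulV (transpose W) u i * x i)     ≈⟨ +-cong (*-identityˡ α)
                                                                        (∑-cong d (λ i → sym (-‿distribˡ-* _ _))) ⟩
    α + ∑ d (λ i → - (mulV (transpose W) u i * x i))        ≈⟨ +-congˡ (-‿distrib-∑ d _) ⟨
    α - dot (mulV (transpose W) u) x                        ≈⟨ +-congˡ (-‿cong (dot-mulV-transpose W u x)) ⟩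
    α - dot u (mulV W x)                                    ∎

  t≈ut·powV : ∀ β k → t β k ≈ dot ut (powV (Wt β) k vt)
  t≈ut·powV β k = dot-congʳ ut (mulV-pow (Wt β) k vt)

  t-zero : ∀ β → t β 0 ≈ 1#
  t-zero β = trans (t≈ut·powV β 0)
    (trans (+-cong (*-identityʳ 1#) (dot-zeroʳ (ut ∘ fs))) (+-identityʳ 1#))

  powV-Wt₀ : ∀ m → powV (Wt 0#) (suc m) vt ≋ 0# ∷ Mʲv m
  powV-Wt₀ zero    = ≋-trans (mulV-cong (Wt 0#) vt≋1∷0) (≋-trans (Wt-mulV-∷ 0# 1# _)
    (∷-cong (zeroˡ 1#) (λ i → trans (+-cong (*-identityʳ (v i)) (mulV-zero M i)) (+-identityʳ (v i)))))
  powV-Wt₀ (suc m) = ≋-trans (mulV-cong (Wt 0#) (powV-Wt₀ m)) (≋-trans (Wt-mulV-∷ 0# 0# _)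
    (∷-cong (zeroˡ 0#) (λ i → trans (+-congʳ (zeroʳ (v i))) (+-identityˡ _))))

  s≈t₀ : s ≈ₛ t 0#
  s≈t₀ zero    = sym (t-zero 0#)
  s≈t₀ (suc m) = begin
    s (suc m)                           ≈⟨ s-suc m ⟩
    - b m                               ≈⟨ +-identityˡ _ ⟨
    0# - b m                            ≈⟨ ut-dot-∷ 0# (Mʲv m) ⟨
    dot ut (0# ∷ Mʲv m)                 ≈⟨ dot-congʳ ut (powV-Wt₀ m) ⟨
    dot ut (powV (Wt 0#) (suc m) vt)    ≈⟨ t≈ut·powV 0# (suc m) ⟨
    t 0# (suc m)                        ∎

  -- Σ_{j<k} Mʲ v, in Horner form.
  ∑Mʲv : ℕ → Vector d
  ∑Mʲv zero    i = 0#
  ∑Mʲv (suc k) i = v i + mulV M (∑Mʲv k) i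

  ∑Mʲv-suc : ∀ k → ∑Mʲv (suc k) ≋ (λ i → ∑Mʲv k i + Mʲv k i)
  ∑Mʲv-suc zero    i = trans (+-congˡ (mulV-zero M i)) (trans (+-identityʳ (v i)) (sym (+-identityˡ (v i))))
  ∑Mʲv-suc (suc k) i = trans (+-congˡ (trans (mulV-cong M (∑Mʲv-suc k) i) (mulV-distrib-+ M _ _ i)))
                             (sym (+-assoc _ _ _))

  powV-Wt₁ : ∀ k → powV (Wt 1#) k vt ≋ 1# ∷ ∑Mʲv k
  powV-Wt₁ zero    = vt≋1∷0
  powV-Wt₁ (suc k) = ≋-trans (mulV-cong (Wt 1#) (powV-Wt₁ k)) (≋-trans (Wt-mulV-∷ 1# 1# _)
    (∷-cong (*-identityʳ 1#) (λ i → +-congʳ (*-identityʳ (v i)))))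

  t₁≈1-uᵀW∑Mʲv : ∀ k → t 1# k ≈ 1# - dot u (mulV W (∑Mʲv k))
  t₁≈1-uᵀW∑Mʲv k = trans (t≈ut·powV 1# k) (trans (dot-congʳ ut (powV-Wt₁ k)) (ut-dot-∷ 1# _))

  t₁≈x·t₁+s : t 1# ≈ₛ (shift (t 1#) +ₛ s)
  t₁≈x·t₁+s zero    = trans (t-zero 1#) (sym (+-identityˡ 1#))
  t₁≈x·t₁+s (suc k) = begin
    t 1# (suc k)                                ≈⟨ t₁≈1-uᵀW∑Mʲv (suc k) ⟩
    1# - dot u (mulV W (∑Mʲv (suc k)))          ≈⟨ +-congˡ (-‿cong uᵀW∑Mʲv-suc) ⟩
    1# - (dot u (mulV W (∑Mʲv k)) + b k)        ≈⟨ +-congˡ (-‿+-comm _ _) ⟨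
    1# + (- dot u (mulV W (∑Mʲv k)) + - b k)    ≈⟨ +-assoc _ _ _ ⟨
    (1# - dot u (mulV W (∑Mʲv k))) + - b k      ≈⟨ +-cong (t₁≈1-uᵀW∑Mʲv k) (s-suc k) ⟨
    t 1# k + s (suc k)                          ∎
    where
    uᵀW∑Mʲv-suc : dot u (mulV W (∑Mʲv (suc k))) ≈ dot u (mulV W (∑Mʲv k)) + b k
    uᵀW∑Mʲv-suc = trans (dot-congʳ u (≋-trans (mulV-cong W (∑Mʲv-suc k)) (mulV-distrib-+ W _ _)))
                        (dot-distribʳ-+ u _ _)

  r⋆[1-x]⋆t₁≈1 : ((r ⋆ oneMinusX) ⋆ t 1#) ≈ₛ oneS
  r⋆[1-x]⋆t₁≈1 n = begin
    ((r ⋆ oneMinusX) ⋆ t 1#) n              ≈⟨ ⋆-cong {g = t 1#} (⋆-oneMinusX r) (λ _ → refl) n ⟩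
    ((r -ₛ shift r) ⋆ t 1#) n               ≈⟨ ⋆-distribʳ-- r (shift r) (t 1#) n ⟩
    P n - (shift r ⋆ t 1#) n                ≈⟨ +-congˡ (-‿cong (shift-⋆ r (t 1#) n)) ⟩
    P n - shift P n                         ≈⟨ +-congʳ (P≈x·P+1 n) ⟩
    (shift P n + oneS n) - shift P n        ≈⟨ xyx⁻¹≈y (shift P n) (oneS n) ⟩
    oneS n                                  ∎
    where
    P = r ⋆ t 1#
    P≈x·P+1 : P ≈ₛ (shift P +ₛ oneS)
    P≈x·P+1 n = begin
      P n                               ≈⟨ ⋆-cong {r} (λ _ → refl) t₁≈x·t₁+s n ⟩
      (r ⋆ (shift (t 1#) +ₛ s)) n       ≈⟨ ⋆-distribˡ-+ r (shift (t 1#)) s n ⟩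
      (r ⋆ shift (t 1#)) n + (r ⋆ s) n  ≈⟨ +-cong (⋆-shift r (t 1#) n) (r⋆s≈1 n) ⟩
      shift P n + oneS n                ∎

proposition22 : ∀ {c ℓ} (R : CommutativeRing c ℓ) →
    let open CommutativeRing R in
    let open FPS R in
    (d : ℕ) (u v : Vector d) (W : Mat d d) → dot u v ≈ 1# →
    let open Setup u v W in
    ((r ⋆ s) ≈ₛ oneS) × (s ≈ₛ t 0#) × (((r ⋆ oneMinusX) ⋆ t 1#) ≈ₛ oneS)
proposition22 R d u v W u·v≈1 = r⋆s≈1 , s≈t₀ , r⋆[1-x]⋆t₁≈1
  where open Proposition22 R u v W u·v≈1
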